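{- For $i=1,2$ let $N_i$ be a primitive cellular pseudomanifold and $f_i:V(N_i)\to\mathbb Z^+$. Then $\langle N_1,f_1\rangle$ and $\langle N_2,f_2\rangle$ are isomorphic if and only if there is an isomorphism $\varphi:N_2\to N_1$ such that $f_2=f_1\circ\varphi$.
   Context: A finite lattice $(X,<)$ is ranked if there is $\rho:X\to\mathbb N$ such that for each $x$ every maximal chain from $\mathbf 0$ to $x$ has length $\rho(x)$. For a ranked lattice $L$ with top $\mathbf 1$, $\Lambda(L)$ is the graph on the elements of rank $\rho(\mathbf 1)-1$, with $\sigma\ne\gamma$ adjacent iff $\rho(\sigma\wedge\gamma)=\rho(\mathbf 1)-2$. A cellular pseudomanifold is a finite ranked lattice $M$ such that for all $x<z$: if $\rho(z)=\rho(x)+2$ there are exactly two $y$ with $x<y<z$, and if $\rho(z)>\rho(x)+2$ then $\Lambda([x,z])$ is connected. Vertices are the elements of rank $1$; $V(M)$ is the vertex set. The shadow of a face is the set of vertices below it; faces are identified with shadows. Isomorphism means order isomorphism. For vertices $x,y$, $x\sim y$ iff $x=y$ or the transposition of $x,y$ induces an automorphism. $M$ is primitive if all $\sim$-classes are singletons (such $M$ are in particular proper, i.e. every $\sim$-class is the shadow of a face). For a proper cellular pseudomanifold $N$ and $f:V(N)\to\mathbb Z^+$, choose pairwise disjoint sets $V_x$ ($x\in V(N)$) with $\#V_x=f(x)$; $\langle N,f\rangle$ is the poset, under inclusion, of all subsets $A\subseteq\bigcup_xV_x$ such that $\{x\in V(N):V_x\subseteq A\}$ is the shadow of a face of $N$.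 -}

module Defs where

open import Level using (0ℓ)
open import Data.Nat using (ℕ; zero; suc; _+_; _<_)
open import Data.Fin using (Fin)
open import Data.Bool using (Bool; true)
open import Data.Product using (Σ; ∃; _×_; _,_; proj₁)
open import Data.Sum using (_⊎_)
open import Relation.Nullary using (¬_)
open import Relation.Binary using (Rel; IsPartialOrder)
open import Relation.Binary.Lattice.Definitions using (Supremum; Infimum)
open import Relation.Binary.Morphism.Structures using (IsOrderIsomorphism)
open import Relation.Binary.PropositionalEquality using (_≡_; _≢_)

module Order {n : ℕ} (_⊑_ : Rel (Fin n) 0ℓ) where

  _⊏_ : Rel (Fin n) 0ℓ
  x ⊏ y = x ⊑ y × x ≢ y

  _⋖_ : Rel (Fin n) 0ℓ
  x ⋖ y = x ⊏ y × (∀ z → ¬ (x ⊏ z × z ⊏ y))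

  data MaxChain : Fin n → Fin n → ℕ → Set where
    [] : ∀ {x} → MaxChain x x 0
    _∷_ : ∀ {x y z k} → x ⋖ y → MaxChain y z k → MaxChain x z (suc k)

  IsAutomorphism : (Fin n → Fin n) → Set
  IsAutomorphism α = IsOrderIsomorphism _≡_ _≡_ _⊑_ _⊑_ α

-- Finite ranked lattices (carrier Fin n, equality _≡_).
-- bottom/top/meet/join/rank are recorded as data; they are uniquely
-- determined by the order, so this is the same as asking for existence.

record FinRankedLattice : Set₁ where
  field
    size           : ℕ
    _⊑_            : Rel (Fin size) 0ℓ
    isPartialOrder : IsPartialOrder _≡_ _⊑_
    _∧_            : Fin size → Fin size → Fin size
    _∨_            : Fin size → Fin size → Fin size
    ∧-infimum      : Infimum _⊑_ _∧_
    ∨-supremum     : Supremum _⊑_ _∨_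
    𝟎              : Fin size
    𝟎-least        : ∀ x → 𝟎 ⊑ x
    𝟏              : Fin size
    𝟏-greatest     : ∀ x → x ⊑ 𝟏
    ρ              : Fin size → ℕ
    ranked         : ∀ x k → Order.MaxChain _⊑_ 𝟎 x k → k ≡ ρ x

  open Order _⊑_ public

  -- In the interval, the rank of y is
  -- ρ y ∸ ρ x and meets are the meets of L, so the nodes of Λ([x,z]) are the
  -- y with x ⊑ y ⊑ z and ρ y + 1 ≡ ρ z, and σ ≠ γ are adjacent iff
  -- ρ (σ ∧ γ) + 2 ≡ ρ z.
  ΛNode : Fin size → Fin size → Fin size → Set
  ΛNode x z y = x ⊑ y × y ⊑ z × ρ y + 1 ≡ ρ z

  ΛAdj : Fin size → Fin size → Fin size → Set
  ΛAdj z σ γ = σ ≢ γ × ρ (σ ∧ γ) + 2 ≡ ρ z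

  data ΛPath (x z : Fin size) : Fin size → Fin size → Set where
    here : ∀ {σ} → ΛPath x z σ σ
    step : ∀ {σ τ γ} → ΛNode x z τ → ΛAdj z σ τ → ΛPath x z τ γ → ΛPath x z σ γ

  ΛConnected : Fin size → Fin size → Set
  ΛConnected x z = ∀ σ γ → ΛNode x z σ → ΛNode x z γ → ΛPath x z σ γ

  IsVertex : Fin size → Set
  IsVertex x = ρ x ≡ 1

  Vertex : Set
  Vertex = Σ (Fin size) IsVertex

record IsCellularPseudomanifold (L : FinRankedLattice) : Set where
  open FinRankedLattice L
  field
    diamond   : ∀ x z → x ⊏ z → ρ z ≡ ρ x + 2 →
                Σ (Fin size) λ y₁ → Σ (Fin size) λ y₂ →
                  y₁ ≢ y₂ × (x ⊏ y₁ × y₁ ⊏ z) × (x ⊏ y₂ × y₂ ⊏ z) ×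
                  (∀ y → x ⊏ y → y ⊏ z → y ≡ y₁ ⊎ y ≡ y₂)
    connected : ∀ x z → x ⊏ z → ρ x + 2 < ρ z → ΛConnected x z

module _ (L : FinRankedLattice) where
  open FinRankedLattice L

  _∼_ : Fin size → Fin size → Set
  x ∼ y = x ≡ y ⊎
          Σ (Fin size → Fin size) λ α → IsAutomorphism α ×
            α x ≡ y × α y ≡ x ×
            (∀ u → IsVertex u → u ≢ x → u ≢ y → α u ≡ u)

  IsPrimitive : Set
  IsPrimitive = ∀ x y → IsVertex x → IsVertex y → x ∼ y → x ≡ y

record PrimitiveCPM : Set₁ where
  field
    lattice   : FinRankedLattice
    isCPM     : IsCellularPseudomanifold lattice
    isPrimitive : IsPrimitive lattice
  open FinRankedLattice lattice public

-- The construction ⟨N , f⟩.  V_v = {v} × Fin (f v); the ground set is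
-- U = Σ v, Fin (f v); subsets of U are Bool-valued predicates, compared
-- pointwise; the order is inclusion.

module Blowup (N : FinRankedLattice) (f : FinRankedLattice.Vertex N → ℕ) where
  open FinRankedLattice N

  Ground : Set
  Ground = Σ Vertex λ v → Fin (f v)

  SubsetU : Set
  SubsetU = Ground → Bool

  Covers : SubsetU → Vertex → Set
  Covers A v = ∀ i → A (v , i) ≡ true

  Admissible : SubsetU → Set
  Admissible A = Σ (Fin size) λ φ →
    ∀ (v : Vertex) → (Covers A v → proj₁ v ⊑ φ) × (proj₁ v ⊑ φ → Covers A v)

  Carrier : Set
  Carrier = Σ SubsetU Admissible

  _≈_ : Rel Carrier 0ℓ
  (A , _) ≈ (B , _) = ∀ u → A u ≡ B u

  _⊆_ : Rel Carrier 0ℓ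
  (A , _) ⊆ (B , _) = ∀ u → A u ≡ true → B u ≡ true

BlowupIso : (N₁ : FinRankedLattice) (f₁ : FinRankedLattice.Vertex N₁ → ℕ)
            (N₂ : FinRankedLattice) (f₂ : FinRankedLattice.Vertex N₂ → ℕ) → Set
BlowupIso N₁ f₁ N₂ f₂ =
  Σ (B₁.Carrier → B₂.Carrier) λ h →
    IsOrderIsomorphism B₁._≈_ B₂._≈_ B₁._⊆_ B₂._⊆_ h
  where
    module B₁ = Blowup N₁ f₁
    module B₂ = Blowup N₂ f₂

-- an order isomorphism φ : N₂ → N₁ with f₂ = f₁ ∘ φ on vertices
-- (φ maps vertices to vertices, so q below always exists)
CompatibleIso : (N₁ : FinRankedLattice) (f₁ : FinRankedLattice.Vertex N₁ → ℕ)
                (N₂ : FinRankedLattice) (f₂ : FinRankedLattice.Vertex N₂ → ℕ) → Set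
CompatibleIso N₁ f₁ N₂ f₂ =
  Σ (Fin (FinRankedLattice.size N₂) → Fin (FinRankedLattice.size N₁)) λ φ →
    IsOrderIsomorphism _≡_ _≡_ (FinRankedLattice._⊑_ N₂) (FinRankedLattice._⊑_ N₁) φ ×
    (∀ x (p : FinRankedLattice.IsVertex N₂ x) (q : FinRankedLattice.IsVertex N₁ (φ x)) →
       f₂ (x , p) ≡ f₁ (φ x , q))

module Submission where

-- A face of a cellular pseudomanifold is determined by its shadow, because every face of rank at least 2
-- is the join of the two middle elements of a diamond below it.  An isomorphism ⟨N₁,f₁⟩ ≅ ⟨N₂,f₂⟩ sends
-- singletons to singletons, so it is induced by a bijection of the ground sets that preserves
-- admissibility.  This bijection sends each V_x into a single V_y: otherwise conjugating a transposition
-- inside V_x would give an admissibility-preserving transposition of two points over distinct vertices of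
-- N₂, and such a transposition is induced by an automorphism of N₂ exchanging the two vertices, which
-- primitivity forbids.  The resulting bijection of vertices carries shadows of faces to shadows of faces,
-- hence comes from a lattice isomorphism, and counting fibres in both directions gives f₂ = f₁ ∘ φ.
-- Conversely an isomorphism φ with f₂ = f₁ ∘ φ is transported fibrewise to the ground sets.

open import Defs
open import Axiom.UniquenessOfIdentityProofs using (module Decidable⇒UIP)
open import Data.Bool using (Bool; true; false) renaming (_≟_ to _≟ᵇ_)
open import Data.Bool.Properties using (⇔→≡)
open import Data.Empty using (⊥-elim)
open import Data.Fin using (Fin; cast; fromℕ<) renaming (zero to fzero; _≟_ to _≟ᶠ_)
open import Data.Fin.Induction using (po-wellFounded; po-noetherian)
open import Data.Fin.Properties using (any?; cast-is-id; cast-trans; cast-involutive; injective⇒≤)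
open import Data.Nat using (ℕ; zero; suc; _+_; _≤_; _<_; z<s; s≤s)
open import Data.Nat.Properties using (+-comm; m<m+n; ≤-antisym; ≡-irrelevant)
import Data.Nat.Properties as ℕ
open import Data.Product using (Σ; ∃; ∃₂; _×_; _,_; proj₁; proj₂)
open import Data.Product.Properties using (≡-dec; ,-injectiveʳ-UIP)
open import Data.Sum using (_⊎_; inj₁; inj₂; [_,_]′)
open import Function using (_∘_; flip; case_of_)
open import Function.Bundles using (_⇔_; mk⇔; Equivalence)
open import Function.Properties.Equivalence using () renaming (trans to ⇔-trans; sym to ⇔-sym)
open import Induction.WellFounded using (Acc; acc)
open import Level using (0ℓ)
open import Relation.Binary using (Rel; Decidable; DecidableEquality; IsPartialOrder)
open import Relation.Binary.Morphism.Structures using (IsOrderIsomorphism)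
open import Relation.Binary.PropositionalEquality
  using (_≡_; _≢_; refl; sym; trans; cong; subst; module ≡-Reasoning)
open import Relation.Nullary using (¬_; Dec; yes; no; does; contradiction; ¬?; _×-dec_; _⊎-dec_)
open import Relation.Nullary.Decidable using (dec-true; map′; does-⇔)

dec-true⁻¹ : ∀ {A : Set} (a? : Dec A) → does a? ≡ true → A
dec-true⁻¹ (yes a) _ = a

Fin1-trivial : ∀ {n} → n ≡ 1 → ∀ (i j : Fin n) → i ≡ j
Fin1-trivial refl fzero fzero = refl

Fin-trivial⇒≤1 : ∀ {n} → (∀ (i j : Fin n) → i ≡ j) → n ≤ 1
Fin-trivial⇒≤1 trivial = injective⇒≤ {f = λ _ → fzero} (λ {i} {j} _ → trivial i j)

subst-proj₂-injective : ∀ {J : Set} {B : J → Set} {j} (p q : Σ J B) (e : proj₁ p ≡ j) (e′ : proj₁ q ≡ j) →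
                        subst B e (proj₂ p) ≡ subst B e′ (proj₂ q) → p ≡ q
subst-proj₂-injective (_ , b) (_ , .b) refl refl refl = refl

module _ {I J : Set} {F : I → ℕ} {G : J → ℕ} where

  Σ-transport : (π : I → J) → (∀ i → G (π i) ≡ F i) → Σ I (Fin ∘ F) → Σ J (Fin ∘ G)
  Σ-transport π G∘π (i , a) = π i , cast (sym (G∘π i)) a

  Σ-transport-covers : ∀ (π : I → J) (G∘π : ∀ i → G (π i) ≡ F i) (B : Σ J (Fin ∘ G) → Bool) i →
                       (∀ a → B (Σ-transport π G∘π (i , a)) ≡ true) ⇔ (∀ b → B (π i , b) ≡ true)
  Σ-transport-covers π G∘π B i = mk⇔
    (λ covered b → subst (λ b′ → B (π i , b′) ≡ true) (cast-involutive (sym (G∘π i)) (G∘π i) b)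
                         (covered (cast (G∘π i) b)))
    (λ covered a → covered (cast (sym (G∘π i)) a))

,-cast : ∀ {I : Set} {F : I → ℕ} {i i′ : I} → i′ ≡ i → .(e : F i ≡ F i′) (a : Fin (F i)) →
         _≡_ {A = Σ I (Fin ∘ F)} (i′ , cast e a) (i , a)
,-cast refl e a = cong (_ ,_) (cast-is-id e a)

Σ-transport-cancel : ∀ {I J : Set} {F : I → ℕ} {G : J → ℕ} (π : I → J) (ψ : J → I)
                     (G∘π : ∀ i → G (π i) ≡ F i) (F∘ψ : ∀ j → F (ψ j) ≡ G j) →
                     (∀ i → ψ (π i) ≡ i) → ∀ w → Σ-transport ψ F∘ψ (Σ-transport π G∘π w) ≡ w
Σ-transport-cancel π ψ G∘π F∘ψ ψ∘π (i , a) =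
  trans (cong (ψ (π i) ,_) (cast-trans (sym (G∘π i)) (sym (F∘ψ (π i))) a)) (,-cast (ψ∘π i) _ a)

module Transposition {A : Set} (_≟_ : DecidableEquality A) where

  swap : A → A → A → A
  swap a b w with w ≟ a | w ≟ b
  ... | yes _ | _     = b
  ... | no _  | yes _ = a
  ... | no _  | no _  = w

  swap-ˡ : ∀ a b → swap a b a ≡ b
  swap-ˡ a b with a ≟ a
  ... | yes _ = refl
  ... | no a≢a = contradiction refl a≢a

  swap-ʳ : ∀ a b → swap a b b ≡ a
  swap-ʳ a b with b ≟ a | b ≟ b
  ... | yes b≡a | _     = b≡a
  ... | no _    | yes _ = refl
  ... | no _    | no b≢b = contradiction refl b≢b

  swap-other : ∀ a b {w} → w ≢ a → w ≢ b → swap a b w ≡ w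
  swap-other a b {w} w≢a w≢b with w ≟ a | w ≟ b
  ... | yes w≡a | _     = contradiction w≡a w≢a
  ... | no _    | yes w≡b = contradiction w≡b w≢b
  ... | no _    | no _  = refl

  data SwapView (a b w : A) : Set where
    at-ˡ   : w ≡ a → SwapView a b w
    at-ʳ   : w ≢ a → w ≡ b → SwapView a b w
    away   : w ≢ a → w ≢ b → SwapView a b w

  swapView : ∀ a b w → SwapView a b w
  swapView a b w with w ≟ a | w ≟ b
  ... | yes w≡a | _       = at-ˡ w≡a
  ... | no w≢a  | yes w≡b = at-ʳ w≢a w≡b
  ... | no w≢a  | no w≢b  = away w≢a w≢b

  swap-involutive : ∀ a b w → swap a b (swap a b w) ≡ w
  swap-involutive a b w with swapView a b w
  ... | at-ˡ refl    = trans (cong (swap w b) (swap-ˡ w b)) (swap-ʳ w b)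
  ... | at-ʳ _ refl  = trans (cong (swap a w) (swap-ʳ a w)) (swap-ˡ a w)
  ... | away w≢a w≢b = trans (cong (swap a b) (swap-other a b w≢a w≢b)) (swap-other a b w≢a w≢b)

module _ {A B : Set} (_≟ᴬ_ : DecidableEquality A) (_≟ᴮ_ : DecidableEquality B) where
  private
    module TA = Transposition _≟ᴬ_
    module TB = Transposition _≟ᴮ_
  open TB using (at-ˡ; at-ʳ; away)

  swap-conjugate : (g : A → B) (g⁻¹ : B → A) → (∀ a → g⁻¹ (g a) ≡ a) → (∀ b → g (g⁻¹ b) ≡ b) →
                   ∀ a a′ w → g (TA.swap a a′ (g⁻¹ w)) ≡ TB.swap (g a) (g a′) w
  swap-conjugate g g⁻¹ g⁻¹∘g g∘g⁻¹ a a′ w with TB.swapView (g a) (g a′) w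
  ... | at-ˡ refl = begin
          g (TA.swap a a′ (g⁻¹ (g a)))  ≡⟨ cong (g ∘ TA.swap a a′) (g⁻¹∘g a) ⟩
          g (TA.swap a a′ a)            ≡⟨ cong g (TA.swap-ˡ a a′) ⟩
          g a′                          ≡⟨ TB.swap-ˡ (g a) (g a′) ⟨
          TB.swap (g a) (g a′) (g a)    ∎
    where open ≡-Reasoning
  ... | at-ʳ _ refl = begin
          g (TA.swap a a′ (g⁻¹ (g a′))) ≡⟨ cong (g ∘ TA.swap a a′) (g⁻¹∘g a′) ⟩
          g (TA.swap a a′ a′)           ≡⟨ cong g (TA.swap-ʳ a a′) ⟩
          g a                           ≡⟨ TB.swap-ʳ (g a) (g a′) ⟨
          TB.swap (g a) (g a′) (g a′)   ∎
    where open ≡-Reasoning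
  ... | away w≢ga w≢ga′ = begin
          g (TA.swap a a′ (g⁻¹ w))      ≡⟨ cong g (TA.swap-other a a′ (w≢ga ∘ moved) (w≢ga′ ∘ moved)) ⟩
          g (g⁻¹ w)                     ≡⟨ g∘g⁻¹ w ⟩
          w                             ≡⟨ TB.swap-other (g a) (g a′) w≢ga w≢ga′ ⟨
          TB.swap (g a) (g a′) w        ∎
    where
    open ≡-Reasoning
    moved : ∀ {c} → g⁻¹ w ≡ c → w ≡ g c
    moved refl = sym (g∘g⁻¹ w)

module RankedLatticeProperties (L : FinRankedLattice) where
  open FinRankedLattice L
  open IsPartialOrder isPartialOrder
    using (antisym) renaming (refl to ⊑-refl; trans to ⊑-trans)

  x∧y⊑x : ∀ x y → (x ∧ y) ⊑ x
  x∧y⊑x x y = proj₁ (∧-infimum x y)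

  x∧y⊑y : ∀ x y → (x ∧ y) ⊑ y
  x∧y⊑y x y = proj₁ (proj₂ (∧-infimum x y))

  ∧-greatest : ∀ {x y z} → z ⊑ x → z ⊑ y → z ⊑ (x ∧ y)
  ∧-greatest {x} {y} {z} = proj₂ (proj₂ (∧-infimum x y)) z

  x⊑x∨y : ∀ x y → x ⊑ (x ∨ y)
  x⊑x∨y x y = proj₁ (∨-supremum x y)

  y⊑x∨y : ∀ x y → y ⊑ (x ∨ y)
  y⊑x∨y x y = proj₁ (proj₂ (∨-supremum x y))

  ∨-least : ∀ {x y z} → x ⊑ z → y ⊑ z → (x ∨ y) ⊑ z
  ∨-least {x} {y} {z} = proj₂ (proj₂ (∨-supremum x y)) z

  _⊑?_ : Decidable _⊑_
  x ⊑? y = map′ (λ x∧y≡x → subst (_⊑ y) x∧y≡x (x∧y⊑y x y))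
                (λ x⊑y → antisym (x∧y⊑x x y) (∧-greatest ⊑-refl x⊑y))
                ((x ∧ y) ≟ᶠ x)

  _⊏?_ : Decidable _⊏_
  x ⊏? y = x ⊑? y ×-dec ¬? (x ≟ᶠ y)

  _++_ : ∀ {x y z k m} → MaxChain x y k → MaxChain y z m → MaxChain x z (k + m)
  []       ++ d = d
  (c ∷ cs) ++ d = c ∷ (cs ++ d)

  lower-cover : ∀ {x y} → x ⊏ y → ∃ λ z → x ⊑ z × z ⋖ y
  lower-cover {x} {y} x⊏y = climb x ⊑-refl x⊏y (po-noetherian isPartialOrder x)
    where
    climb : ∀ z → x ⊑ z → z ⊏ y → Acc (flip _⊏_) z → ∃ λ w → x ⊑ w × w ⋖ y
    climb z x⊑z z⊏y (acc rs) with any? (λ w → z ⊏? w ×-dec w ⊏? y)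
    ... | yes (w , z⊏w , w⊏y) = climb w (⊑-trans x⊑z (proj₁ z⊏w)) w⊏y (rs z⊏w)
    ... | no ∄w               = z , x⊑z , z⊏y , λ w z⊏w⊏y → ∄w (w , z⊏w⊏y)

  maxChain : ∀ {x y} → x ⊑ y → ∃ (MaxChain x y)
  maxChain {x} {y} x⊑y = build y x⊑y (po-wellFounded isPartialOrder y)
    where
    build : ∀ y → x ⊑ y → Acc _⊏_ y → ∃ (MaxChain x y)
    build y x⊑y (acc rs) with x ≟ᶠ y
    ... | yes refl = 0 , []
    ... | no x≢y with lower-cover (x⊑y , x≢y)
    ...   | z , x⊑z , z⋖y with build z x⊑z (rs (proj₁ z⋖y))
    ...     | k , c = k + 1 , c ++ (z⋖y ∷ [])

  ρ-𝟎 : ρ 𝟎 ≡ 0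
  ρ-𝟎 = sym (ranked 𝟎 0 [])

  ρ-maxChain : ∀ {x y k} → MaxChain x y k → ρ y ≡ ρ x + k
  ρ-maxChain {x} {y} {k} c with maxChain (𝟎-least x)
  ... | m , c₀ = trans (sym (ranked y (m + k) (c₀ ++ c))) (cong (_+ k) (ranked x m c₀))

  ρ-⋖ : ∀ {x y} → x ⋖ y → ρ y ≡ suc (ρ x)
  ρ-⋖ {x} x⋖y = trans (ρ-maxChain (x⋖y ∷ [])) (+-comm (ρ x) 1)

  ρ-strictMono : ∀ {x y} → x ⊏ y → ρ x < ρ y
  ρ-strictMono {x} (x⊑y , x≢y) with maxChain x⊑y
  ... | zero  , []    = contradiction refl x≢y
  ... | suc k , chain = subst (ρ x <_) (sym (ρ-maxChain chain)) (m<m+n (ρ x) z<s)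

  ⊑∧ρ≡⇒≡ : ∀ {x y} → x ⊑ y → ρ x ≡ ρ y → x ≡ y
  ⊑∧ρ≡⇒≡ {x} {y} x⊑y ρx≡ρy with x ≟ᶠ y
  ... | yes x≡y = x≡y
  ... | no x≢y  = contradiction ρx≡ρy (ℕ.<⇒≢ (ρ-strictMono (x⊑y , x≢y)))

  ρ≡0⇒≡𝟎 : ∀ {x} → ρ x ≡ 0 → x ≡ 𝟎
  ρ≡0⇒≡𝟎 {x} ρx≡0 = sym (⊑∧ρ≡⇒≡ (𝟎-least x) (trans ρ-𝟎 (sym ρx≡0)))

  vertex⊑vertex⇒≡ : ∀ {u v} → IsVertex u → IsVertex v → u ⊑ v → u ≡ v
  vertex⊑vertex⇒≡ ρu≡1 ρv≡1 u⊑v = ⊑∧ρ≡⇒≡ u⊑v (trans ρu≡1 (sym ρv≡1))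

  vertex⋢𝟎 : ∀ {v} → IsVertex v → ¬ v ⊑ 𝟎
  vertex⋢𝟎 {v} ρv≡1 v⊑𝟎 with () ← trans (sym ρv≡1) (trans (cong ρ (antisym v⊑𝟎 (𝟎-least v))) ρ-𝟎)

  Vertex-≡ : ∀ {u v : Vertex} → proj₁ u ≡ proj₁ v → u ≡ v
  Vertex-≡ {u , p} {.u , q} refl = cong (u ,_) (≡-irrelevant p q)

  vertex-⊑⇔≡ : ∀ (u v : Vertex) → proj₁ u ⊑ proj₁ v ⇔ u ≡ v
  vertex-⊑⇔≡ u v = mk⇔ (λ u⊑v → Vertex-≡ (vertex⊑vertex⇒≡ (proj₂ u) (proj₂ v) u⊑v)) (λ { refl → ⊑-refl })

  _≟ᵛ_ : DecidableEquality Vertex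
  _≟ᵛ_ = ≡-dec _≟ᶠ_ (λ p q → yes (≡-irrelevant p q))

  ρ≡suc⇒𝟎⊏ : ∀ {y k} → ρ y ≡ suc k → 𝟎 ⊏ y
  ρ≡suc⇒𝟎⊏ {y} ρy≡ = 𝟎-least y , λ 𝟎≡y → ℕ.0≢1+n (trans (sym ρ-𝟎) (trans (cong ρ 𝟎≡y) ρy≡))

  two-ranks-below : ∀ {x k} → ρ x ≡ suc (suc k) → ∃ λ t → t ⊏ x × ρ x ≡ ρ t + 2
  two-ranks-below {x} ρx≡ with lower-cover (ρ≡suc⇒𝟎⊏ ρx≡)
  ... | w , _ , w⋖x with lower-cover (ρ≡suc⇒𝟎⊏ (ℕ.suc-injective (trans (sym (ρ-⋖ w⋖x)) ρx≡)))
  ...   | t , _ , t⋖w = t , (⊑-trans (proj₁ (proj₁ t⋖w)) (proj₁ (proj₁ w⋖x)) , t≢x) , ρx≡ρt+2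
    where
    ρx≡ρt+2 : ρ x ≡ ρ t + 2
    ρx≡ρt+2 = trans (ρ-⋖ w⋖x) (trans (cong suc (ρ-⋖ t⋖w)) (+-comm 2 (ρ t)))
    t≢x : t ≢ x
    t≢x refl = ℕ.m+1+n≢m (ρ t) (sym ρx≡ρt+2)

module CellularPseudomanifoldProperties (L : FinRankedLattice) (cpm : IsCellularPseudomanifold L) where
  open FinRankedLattice L
  open IsCellularPseudomanifold cpm using (diamond)
  open RankedLatticeProperties L
  open IsPartialOrder isPartialOrder using (antisym) renaming (refl to ⊑-refl; trans to ⊑-trans)

  no-⊏-chain₃ : ∀ {t a b x} → t ⊏ a → a ⊏ b → b ⊏ x → ρ x ≢ ρ t + 2
  no-⊏-chain₃ {t} t⊏a a⊏b b⊏x ρx≡ρt+2 =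
    ℕ.<⇒≢ (ℕ.≤-<-trans (ℕ.≤-trans (s≤s (ρ-strictMono t⊏a)) (ρ-strictMono a⊏b)) (ρ-strictMono b⊏x))
          (sym (trans ρx≡ρt+2 (+-comm (ρ t) 2)))

  -- if the join were strictly below x, then t ⊏ yᵢ ⊏ y₁ ∨ y₂ ⊏ x for an i, a chain too long for [t, x]
  diamond-join : ∀ {t x y₁ y₂} → ρ x ≡ ρ t + 2 → y₁ ≢ y₂ →
                 t ⊏ y₁ → y₁ ⊏ x → t ⊏ y₂ → y₂ ⊏ x → (y₁ ∨ y₂) ≡ x
  diamond-join {t} {x} {y₁} {y₂} ρx≡ρt+2 y₁≢y₂ t⊏y₁ y₁⊏x t⊏y₂ y₂⊏x with (y₁ ∨ y₂) ≟ᶠ x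
  ... | yes j≡x = j≡x
  ... | no j≢x with y₁ ≟ᶠ (y₁ ∨ y₂) | y₂ ≟ᶠ (y₁ ∨ y₂)
  ...   | no y₁≢j  | _        = contradiction ρx≡ρt+2
          (no-⊏-chain₃ t⊏y₁ (x⊑x∨y y₁ y₂ , y₁≢j) (∨-least (proj₁ y₁⊏x) (proj₁ y₂⊏x) , j≢x))
  ...   | yes _    | no y₂≢j  = contradiction ρx≡ρt+2
          (no-⊏-chain₃ t⊏y₂ (y⊑x∨y y₁ y₂ , y₂≢j) (∨-least (proj₁ y₁⊏x) (proj₁ y₂⊏x) , j≢x))
  ...   | yes y₁≡j | yes y₂≡j = contradiction (trans y₁≡j (sym y₂≡j)) y₁≢y₂

  join-decomposition : ∀ {x k} → ρ x ≡ suc (suc k) → ∃₂ λ y₁ y₂ → y₁ ⊏ x × y₂ ⊏ x × (y₁ ∨ y₂) ≡ x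
  join-decomposition {x} ρx≡ =
    case two-ranks-below ρx≡ of λ (t , t⊏x , ρx≡ρt+2) →
    case diamond t x t⊏x ρx≡ρt+2 of λ (y₁ , y₂ , y₁≢y₂ , (t⊏y₁ , y₁⊏x) , (t⊏y₂ , y₂⊏x) , _) →
    y₁ , y₂ , y₁⊏x , y₂⊏x , diamond-join ρx≡ρt+2 y₁≢y₂ t⊏y₁ y₁⊏x t⊏y₂ y₂⊏x

  shadow⊆⇒⊑ : ∀ {x y} → (∀ v → IsVertex v → v ⊑ x → v ⊑ y) → x ⊑ y
  shadow⊆⇒⊑ {x} {y} = go x (po-wellFounded isPartialOrder x)
    where
    go : ∀ x → Acc _⊏_ x → (∀ v → IsVertex v → v ⊑ x → v ⊑ y) → x ⊑ y
    go x (acc rs) below with ρ x in ρx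
    ... | zero        = subst (_⊑ y) (sym (ρ≡0⇒≡𝟎 ρx)) (𝟎-least y)
    ... | suc zero    = below x ρx ⊑-refl
    ... | suc (suc _) = case join-decomposition ρx of λ (y₁ , y₂ , y₁⊏x , y₂⊏x , y₁∨y₂≡x) →
          subst (_⊑ y) y₁∨y₂≡x (∨-least (go y₁ (rs y₁⊏x) (restrict y₁⊏x)) (go y₂ (rs y₂⊏x) (restrict y₂⊏x)))
      where
      restrict : ∀ {z} → z ⊏ x → ∀ v → IsVertex v → v ⊑ z → v ⊑ y
      restrict z⊏x v v-vertex v⊑z = below v v-vertex (⊑-trans v⊑z (proj₁ z⊏x))

  shadow-injective : ∀ {x y} → (∀ v → IsVertex v → v ⊑ x ⇔ v ⊑ y) → x ≡ y
  shadow-injective same = antisym (shadow⊆⇒⊑ (λ v p → Equivalence.to (same v p)))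
                                  (shadow⊆⇒⊑ (λ v p → Equivalence.from (same v p)))

module _ (L L′ : FinRankedLattice) where
  private
    module L  = FinRankedLattice L
    module L′ = FinRankedLattice L′

  record ShadowIso : Set where
    field
      π           : L.Vertex → L′.Vertex
      π⁻¹         : L′.Vertex → L.Vertex
      π⁻¹∘π       : ∀ v → π⁻¹ (π v) ≡ v
      π∘π⁻¹       : ∀ v′ → π (π⁻¹ v′) ≡ v′
      pull        : Fin L′.size → Fin L.size
      pull-shadow : ∀ ψ v → proj₁ v L.⊑ pull ψ ⇔ proj₁ (π v) L′.⊑ ψ
      push        : Fin L.size → Fin L′.size
      push-shadow : ∀ φ v′ → proj₁ v′ L′.⊑ push φ ⇔ proj₁ (π⁻¹ v′) L.⊑ φ

    π-⇔ : ∀ v v′ → π v ≡ v′ ⇔ v ≡ π⁻¹ v′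
    π-⇔ v v′ = mk⇔ (λ { refl → sym (π⁻¹∘π v) }) (λ { refl → π∘π⁻¹ v′ })

module ShadowIsoProperties {L L′ : FinRankedLattice}
                           (cpm : IsCellularPseudomanifold L) (cpm′ : IsCellularPseudomanifold L′)
                           (S : ShadowIso L L′) where
  open ShadowIso S
  private
    module L  = FinRankedLattice L
    module L′ = FinRankedLattice L′
    module P  = RankedLatticeProperties L
    module P′ = RankedLatticeProperties L′
    module C  = CellularPseudomanifoldProperties L cpm
    module C′ = CellularPseudomanifoldProperties L′ cpm′
    open IsPartialOrder L.isPartialOrder using () renaming (trans to ⊑-trans; reflexive to ⊑-reflexive)
    open IsPartialOrder L′.isPartialOrder using () renaming (antisym to ⊑′-antisym; trans to ⊑′-trans)

  pull-shadow⁻¹ : ∀ ψ v′ → proj₁ (π⁻¹ v′) L.⊑ pull ψ ⇔ proj₁ v′ L′.⊑ ψ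
  pull-shadow⁻¹ ψ v′ = subst (λ w → _ ⇔ proj₁ w L′.⊑ ψ) (π∘π⁻¹ v′) (pull-shadow ψ (π⁻¹ v′))

  pull-mono : ∀ {ψ ψ′} → ψ L′.⊑ ψ′ → pull ψ L.⊑ pull ψ′
  pull-mono {ψ} {ψ′} ψ⊑ψ′ = C.shadow⊆⇒⊑ λ v p v⊑pullψ →
    Equivalence.from (pull-shadow ψ′ (v , p)) (⊑′-trans (Equivalence.to (pull-shadow ψ (v , p)) v⊑pullψ) ψ⊑ψ′)

  pull-cancel : ∀ {ψ ψ′} → pull ψ L.⊑ pull ψ′ → ψ L′.⊑ ψ′
  pull-cancel {ψ} {ψ′} pullψ⊑pullψ′ = C′.shadow⊆⇒⊑ λ v′ p v′⊑ψ →
    Equivalence.to (pull-shadow⁻¹ ψ′ (v′ , p))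
      (⊑-trans (Equivalence.from (pull-shadow⁻¹ ψ (v′ , p)) v′⊑ψ) pullψ⊑pullψ′)

  pull∘push : ∀ φ → pull (push φ) ≡ φ
  pull∘push φ = C.shadow-injective λ v p →
    ⇔-trans (pull-shadow (push φ) (v , p))
      (subst (λ w → _ ⇔ proj₁ w L.⊑ φ) (π⁻¹∘π (v , p)) (push-shadow φ (π (v , p))))

  pull-isOrderIsomorphism : IsOrderIsomorphism _≡_ _≡_ L′._⊑_ L._⊑_ pull
  pull-isOrderIsomorphism = record
    { isOrderMonomorphism = record
      { isOrderHomomorphism = record { cong = cong pull ; mono = pull-mono }
      ; injective           = λ e → ⊑′-antisym (pull-cancel (⊑-reflexive e))
                                                (pull-cancel (⊑-reflexive (sym e)))
      ; cancel              = pull-cancel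
      }
    ; surjective = λ φ → push φ , λ { refl → pull∘push φ }
    }

  pull-vertex : ∀ v′ → pull (proj₁ v′) ≡ proj₁ (π⁻¹ v′)
  pull-vertex v′ = C.shadow-injective λ v p →
    ⇔-trans (pull-shadow (proj₁ v′) (v , p))
      (⇔-trans (P′.vertex-⊑⇔≡ (π (v , p)) v′)
        (⇔-trans (π-⇔ (v , p) v′) (⇔-sym (P.vertex-⊑⇔≡ (v , p) (π⁻¹ v′)))))

module OrderIsoProperties {L′ L : FinRankedLattice}
                          (φ : Fin (FinRankedLattice.size L′) → Fin (FinRankedLattice.size L))
                          (φ-iso : IsOrderIsomorphism _≡_ _≡_ (FinRankedLattice._⊑_ L′)
                                                              (FinRankedLattice._⊑_ L) φ)
                          where
  private
    module L  = FinRankedLattice L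
    module L′ = FinRankedLattice L′
    module P  = RankedLatticeProperties L
    module P′ = RankedLatticeProperties L′
  open IsOrderIsomorphism φ-iso using (mono; cancel; injective; surjective)
  open IsPartialOrder L.isPartialOrder using (antisym)

  φ⁻¹ : Fin L.size → Fin L′.size
  φ⁻¹ x = proj₁ (surjective x)

  φ∘φ⁻¹ : ∀ x → φ (φ⁻¹ x) ≡ x
  φ∘φ⁻¹ x = proj₂ (surjective x) refl

  φ⁻¹∘φ : ∀ y → φ⁻¹ (φ y) ≡ y
  φ⁻¹∘φ y = injective (φ∘φ⁻¹ (φ y))

  ⊑-φ⁻¹ : ∀ {x y} → x L′.⊑ φ⁻¹ y ⇔ φ x L.⊑ y
  ⊑-φ⁻¹ {x} {y} = mk⇔ (λ x⊑ → subst (φ x L.⊑_) (φ∘φ⁻¹ y) (mono x⊑))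
                      (λ φx⊑ → cancel (subst (φ x L.⊑_) (sym (φ∘φ⁻¹ y)) φx⊑))

  φ⁻¹-⊑ : ∀ {x y} → φ⁻¹ x L′.⊑ y ⇔ x L.⊑ φ y
  φ⁻¹-⊑ {x} {y} = mk⇔ (λ ⊑y → subst (L._⊑ φ y) (φ∘φ⁻¹ x) (mono ⊑y))
                      (λ x⊑ → cancel (subst (L._⊑ φ y) (sym (φ∘φ⁻¹ x)) x⊑))

  ⊏-preserved : ∀ {x y} → x L′.⊏ y → φ x L.⊏ φ y
  ⊏-preserved (x⊑y , x≢y) = mono x⊑y , x≢y ∘ injective

  ⊏-reflected : ∀ {x y} → φ x L.⊏ φ y → x L′.⊏ y
  ⊏-reflected (φx⊑φy , φx≢φy) = cancel φx⊑φy , φx≢φy ∘ cong φ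

  ⋖-preserved : ∀ {x y} → x L′.⋖ y → φ x L.⋖ φ y
  ⋖-preserved {x} {y} (x⊏y , nothing-between) = ⊏-preserved x⊏y , λ z (φx⊏z , z⊏φy) →
    nothing-between (φ⁻¹ z) ( ⊏-reflected (subst (φ x L.⊏_) (sym (φ∘φ⁻¹ z)) φx⊏z)
                            , ⊏-reflected (subst (L._⊏ φ y) (sym (φ∘φ⁻¹ z)) z⊏φy))

  maxChain-preserved : ∀ {x y k} → L′.MaxChain x y k → L.MaxChain (φ x) (φ y) k
  maxChain-preserved L′.[]         = L.[]
  maxChain-preserved (c L′.∷ cs)   = ⋖-preserved c L.∷ maxChain-preserved cs

  φ-𝟎 : φ L′.𝟎 ≡ L.𝟎
  φ-𝟎 = antisym (Equivalence.to ⊑-φ⁻¹ (L′.𝟎-least (φ⁻¹ L.𝟎))) (L.𝟎-least _)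

  ρ-φ : ∀ x → L.ρ (φ x) ≡ L′.ρ x
  ρ-φ x with P′.maxChain (L′.𝟎-least x)
  ... | k , chain =
        trans (sym (L.ranked (φ x) k (subst (λ z → L.MaxChain z (φ x) k) φ-𝟎 (maxChain-preserved chain))))
              (L′.ranked x k chain)

  φ⁻¹-vertex : L.Vertex → L′.Vertex
  φ⁻¹-vertex (x , x-vertex) = φ⁻¹ x , trans (sym (ρ-φ (φ⁻¹ x))) (trans (cong L.ρ (φ∘φ⁻¹ x)) x-vertex)

  φ-vertex : L′.Vertex → L.Vertex
  φ-vertex (y , y-vertex) = φ y , trans (ρ-φ y) y-vertex

  φ-shadow : ∀ ψ (v : L.Vertex) → proj₁ v L.⊑ φ ψ ⇔ proj₁ (φ⁻¹-vertex v) L′.⊑ ψ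
  φ-shadow _ _ = ⇔-sym φ⁻¹-⊑

  φ⁻¹-shadow : ∀ χ (v′ : L′.Vertex) → proj₁ v′ L′.⊑ φ⁻¹ χ ⇔ proj₁ (φ-vertex v′) L.⊑ χ
  φ⁻¹-shadow _ _ = ⊑-φ⁻¹

  shadowIso : ShadowIso L L′
  shadowIso = record
    { π           = φ⁻¹-vertex
    ; π⁻¹         = φ-vertex
    ; π⁻¹∘π       = λ v → P.Vertex-≡ (φ∘φ⁻¹ (proj₁ v))
    ; π∘π⁻¹       = λ v′ → P′.Vertex-≡ (φ⁻¹∘φ (proj₁ v′))
    ; pull        = φ
    ; pull-shadow = φ-shadow
    ; push        = φ⁻¹
    ; push-shadow = φ⁻¹-shadow
    }

module SetSystem {U : Set} (Admissible : (U → Bool) → Set) where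

  Carrier : Set
  Carrier = Σ (U → Bool) Admissible

  _≈_ : Rel Carrier 0ℓ
  A ≈ B = ∀ u → proj₁ A u ≡ proj₁ B u

  _⊆_ : Rel Carrier 0ℓ
  A ⊆ B = ∀ u → proj₁ A u ≡ true → proj₁ B u ≡ true

  ⊆-respˡ-≈ : ∀ {A A′ B} → A ≈ A′ → A ⊆ B → A′ ⊆ B
  ⊆-respˡ-≈ A≈A′ A⊆B u A′u = A⊆B u (trans (A≈A′ u) A′u)

  ⊆-respʳ-≈ : ∀ {A B B′} → B ≈ B′ → A ⊆ B → A ⊆ B′
  ⊆-respʳ-≈ B≈B′ A⊆B u Au = trans (sym (B≈B′ u)) (A⊆B u Au)

SystemOrderIso : {U₁ U₂ : Set} → ((U₁ → Bool) → Set) → ((U₂ → Bool) → Set) → Set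
SystemOrderIso Adm₁ Adm₂ = Σ (S₁.Carrier → S₂.Carrier) (IsOrderIsomorphism S₁._≈_ S₂._≈_ S₁._⊆_ S₂._⊆_)
  where
  module S₁ = SetSystem Adm₁
  module S₂ = SetSystem Adm₂

record SystemIso {U₁ U₂ : Set} (Adm₁ : (U₁ → Bool) → Set) (Adm₂ : (U₂ → Bool) → Set) : Set where
  field
    to                  : U₁ → U₂
    from                : U₂ → U₁
    from∘to             : ∀ u → from (to u) ≡ u
    to∘from             : ∀ w → to (from w) ≡ w
    image-admissible    : ∀ A → Adm₁ A → Adm₂ (A ∘ from)
    preimage-admissible : ∀ B → Adm₂ B → Adm₁ (B ∘ to)

SystemIso-sym : ∀ {U₁ U₂} {Adm₁ : (U₁ → Bool) → Set} {Adm₂ : (U₂ → Bool) → Set} →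
                SystemIso Adm₁ Adm₂ → SystemIso Adm₂ Adm₁
SystemIso-sym G = record
  { to = from ; from = to ; from∘to = to∘from ; to∘from = from∘to
  ; image-admissible = preimage-admissible ; preimage-admissible = image-admissible }
  where open SystemIso G

record IsAtomicSetSystem {U : Set} (Admissible : (U → Bool) → Set) : Set where
  field
    _≟_                  : DecidableEquality U
    nonempty?            : ∀ (A : U → Bool) → Dec (∃ λ u → A u ≡ true)
    ∅-admissible         : Admissible (λ _ → false)
    singleton-admissible : ∀ u → Admissible (λ w → does (u ≟ w))
    admissible-resp      : ∀ {A B} → (∀ u → A u ≡ B u) → Admissible A → Admissible B

systemIso⇒orderIso : ∀ {U₁ U₂} {Adm₁ : (U₁ → Bool) → Set} {Adm₂ : (U₂ → Bool) → Set} →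
                     SystemIso Adm₁ Adm₂ → SystemOrderIso Adm₁ Adm₂
systemIso⇒orderIso {Adm₁ = Adm₁} {Adm₂} G = image , record
  { isOrderMonomorphism = record
    { isOrderHomomorphism = record
      { cong = λ A≈B w → A≈B (from w)
      ; mono = λ A⊆B w → A⊆B (from w) }
    ; injective = λ {A} {B} A≈B u → subst (λ v → proj₁ A v ≡ proj₁ B v) (from∘to u) (A≈B (to u))
    ; cancel    = λ {A} {B} A⊆B u →
                    subst (λ v → proj₁ A v ≡ true → proj₁ B v ≡ true) (from∘to u) (A⊆B (to u)) }
  ; surjective = λ (B , B-adm) → ((B ∘ to) , preimage-admissible B B-adm) ,
                                 λ z≈ w → trans (z≈ (from w)) (cong B (to∘from w))
  }
  where
  open SystemIso G
  image : SetSystem.Carrier Adm₁ → SetSystem.Carrier Adm₂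
  image (A , A-adm) = A ∘ from , image-admissible A A-adm

module AtomImage {U₁ U₂ : Set} {Adm₁ : (U₁ → Bool) → Set} {Adm₂ : (U₂ → Bool) → Set}
                 (atomic₁ : IsAtomicSetSystem Adm₁) (atomic₂ : IsAtomicSetSystem Adm₂)
                 (m : SetSystem.Carrier Adm₁ → SetSystem.Carrier Adm₂)
                 (m-mono : ∀ {A B} → SetSystem._⊆_ Adm₁ A B → SetSystem._⊆_ Adm₂ (m A) (m B))
                 (m-cancel : ∀ {A B} → SetSystem._⊆_ Adm₂ (m A) (m B) → SetSystem._⊆_ Adm₁ A B)
                 where
  open IsAtomicSetSystem atomic₁ using (_≟_; ∅-admissible; singleton-admissible)
  open IsAtomicSetSystem atomic₂ using (nonempty?)

  singleton : U₁ → SetSystem.Carrier Adm₁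
  singleton u = (λ w → does (u ≟ w)) , singleton-admissible u

  ∈-singleton : ∀ u → proj₁ (singleton u) u ≡ true
  ∈-singleton u = dec-true (u ≟ u) refl

  singleton-⊆ : ∀ A u → proj₁ A u ≡ true → SetSystem._⊆_ Adm₁ (singleton u) A
  singleton-⊆ A u u∈A w u≡w = subst (λ v → proj₁ A v ≡ true) (dec-true⁻¹ (u ≟ w) u≡w) u∈A

  -- m {u} is not below m ∅, hence nonempty
  image-nonempty : ∀ u → ∃ λ w → proj₁ (m (singleton u)) w ≡ true
  image-nonempty u with nonempty? (proj₁ (m (singleton u)))
  ... | yes nonempty = nonempty
  ... | no empty with () ← m-cancel {singleton u} {(λ _ → false) , ∅-admissible}
                             (λ w w∈ → contradiction (w , w∈) empty) u (∈-singleton u)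

  point : U₁ → U₂
  point u = proj₁ (image-nonempty u)

  point-∈ : ∀ A u → proj₁ A u ≡ true → proj₁ (m A) (point u) ≡ true
  point-∈ A u u∈A = m-mono (singleton-⊆ A u u∈A) (point u) (proj₂ (image-nonempty u))

module SystemOrderIsoInverse {U₁ U₂ : Set} {Adm₁ : (U₁ → Bool) → Set} {Adm₂ : (U₂ → Bool) → Set}
                             (h : SetSystem.Carrier Adm₁ → SetSystem.Carrier Adm₂)
                             (h-iso : IsOrderIsomorphism (SetSystem._≈_ Adm₁) (SetSystem._≈_ Adm₂)
                                                         (SetSystem._⊆_ Adm₁) (SetSystem._⊆_ Adm₂) h)
                             where
  private
    module S₁ = SetSystem Adm₁
    module S₂ = SetSystem Adm₂
  open IsOrderIsomorphism h-iso using (mono; injective; surjective)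

  h⁻¹ : S₂.Carrier → S₁.Carrier
  h⁻¹ B = proj₁ (surjective B)

  h∘h⁻¹ : ∀ B → h (h⁻¹ B) S₂.≈ B
  h∘h⁻¹ B = proj₂ (surjective B) (λ _ → refl)

  h⁻¹∘h : ∀ A → h⁻¹ (h A) S₁.≈ A
  h⁻¹∘h A = injective (h∘h⁻¹ (h A))

  h⁻¹-mono : ∀ {B B′} → B S₂.⊆ B′ → h⁻¹ B S₁.⊆ h⁻¹ B′
  h⁻¹-mono {B} {B′} B⊆B′ = IsOrderIsomorphism.cancel h-iso
    (S₂.⊆-respʳ-≈ {h (h⁻¹ B)} {B′} {h (h⁻¹ B′)} (λ w → sym (h∘h⁻¹ B′ w))
                  (S₂.⊆-respˡ-≈ {B} {h (h⁻¹ B)} {B′} (λ w → sym (h∘h⁻¹ B w)) B⊆B′))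

  h⁻¹-cancel : ∀ {B B′} → h⁻¹ B S₁.⊆ h⁻¹ B′ → B S₂.⊆ B′
  h⁻¹-cancel {B} {B′} h⁻¹B⊆h⁻¹B′ =
    S₂.⊆-respʳ-≈ {B} {h (h⁻¹ B′)} {B′} (h∘h⁻¹ B′)
                 (S₂.⊆-respˡ-≈ {h (h⁻¹ B)} {B} {h (h⁻¹ B′)} (h∘h⁻¹ B) (mono h⁻¹B⊆h⁻¹B′))

orderIso⇒systemIso : ∀ {U₁ U₂} {Adm₁ : (U₁ → Bool) → Set} {Adm₂ : (U₂ → Bool) → Set} →
                     IsAtomicSetSystem Adm₁ → IsAtomicSetSystem Adm₂ →
                     SystemOrderIso Adm₁ Adm₂ → SystemIso Adm₁ Adm₂
orderIso⇒systemIso {U₁} {U₂} {Adm₁} {Adm₂} atomic₁ atomic₂ (h , h-iso) = record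
  { to = to ; from = from ; from∘to = from∘to ; to∘from = to∘from
  ; image-admissible    = λ A A-adm → admissible-resp₂ (h-image A A-adm) (proj₂ (h (A , A-adm)))
  ; preimage-admissible = λ B B-adm → admissible-resp₁ (h⁻¹-image B B-adm) (proj₂ (h⁻¹ (B , B-adm)))
  }
  where
  open IsOrderIsomorphism h-iso using (mono; cancel)
  open SystemOrderIsoInverse h h-iso
  open IsAtomicSetSystem atomic₁ using () renaming (_≟_ to _≟₁_; admissible-resp to admissible-resp₁)
  open IsAtomicSetSystem atomic₂ using () renaming (_≟_ to _≟₂_; admissible-resp to admissible-resp₂)

  module H   = AtomImage atomic₁ atomic₂ h mono cancel
  module H⁻¹ = AtomImage atomic₂ atomic₁ h⁻¹ h⁻¹-mono h⁻¹-cancel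

  to : U₁ → U₂
  to = H.point

  from : U₂ → U₁
  from = H⁻¹.point

  -- to u ∈ h {u}, so from (to u) ∈ h⁻¹ (h {u}) ≈ {u}
  from∘to : ∀ u → from (to u) ≡ u
  from∘to u = sym (dec-true⁻¹ (u ≟₁ from (to u))
    (trans (sym (h⁻¹∘h (H.singleton u) (from (to u))))
           (H⁻¹.point-∈ (h (H.singleton u)) (to u) (H.point-∈ (H.singleton u) u (H.∈-singleton u)))))

  to∘from : ∀ w → to (from w) ≡ w
  to∘from w = sym (dec-true⁻¹ (w ≟₂ to (from w))
    (trans (sym (h∘h⁻¹ (H⁻¹.singleton w) (to (from w))))
           (H.point-∈ (h⁻¹ (H⁻¹.singleton w)) (from w) (H⁻¹.point-∈ (H⁻¹.singleton w) w (H⁻¹.∈-singleton w)))))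

  h-image : ∀ A A-adm w → proj₁ (h (A , A-adm)) w ≡ A (from w)
  h-image A A-adm w = ⇔→≡ (mk⇔
    (λ w∈hA → trans (sym (h⁻¹∘h (A , A-adm) (from w))) (H⁻¹.point-∈ (h (A , A-adm)) w w∈hA))
    (λ from-w∈A → subst (λ v → proj₁ (h (A , A-adm)) v ≡ true) (to∘from w)
                        (H.point-∈ (A , A-adm) (from w) from-w∈A)))

  h⁻¹-image : ∀ B B-adm u → proj₁ (h⁻¹ (B , B-adm)) u ≡ B (to u)
  h⁻¹-image B B-adm u = ⇔→≡ (mk⇔
    (λ u∈h⁻¹B → trans (sym (h∘h⁻¹ (B , B-adm) (to u))) (H.point-∈ (h⁻¹ (B , B-adm)) u u∈h⁻¹B))
    (λ to-u∈B → subst (λ v → proj₁ (h⁻¹ (B , B-adm)) v ≡ true) (from∘to u)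
                      (H⁻¹.point-∈ (B , B-adm) (to u) to-u∈B)))

module BlowupBasics (N : FinRankedLattice) (f : FinRankedLattice.Vertex N → ℕ) where
  open FinRankedLattice N
  open RankedLatticeProperties N
  open Blowup N f

  fibre : Ground → Vertex
  fibre = proj₁

  _≟ᴳ_ : DecidableEquality Ground
  _≟ᴳ_ = ≡-dec _≟ᵛ_ _≟ᶠ_

  nonempty? : ∀ (A : SubsetU) → Dec (∃ λ w → A w ≡ true)
  nonempty? A = map′ (λ (x , p , i , Ai) → ((x , p) , i) , Ai) (λ (((x , p) , i) , Ai) → x , p , i , Ai)
                     (any? meets-fibre?)
    where
    meets-fibre? : ∀ x → Dec (Σ (IsVertex x) λ p → ∃ λ i → A ((x , p) , i) ≡ true)
    meets-fibre? x with ρ x ℕ.≟ 1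
    ... | no ¬p = no (¬p ∘ proj₁)
    ... | yes p = map′ (p ,_)
                       (λ (q , meets) → subst (λ q → ∃ λ i → A ((x , q) , i) ≡ true) (≡-irrelevant q p) meets)
                       (any? (λ i → A ((x , p) , i) ≟ᵇ true))

  ,-injectiveʳ-fibre : ∀ {v} {i j : Fin (f v)} → _≡_ {A = Ground} (v , i) (v , j) → i ≡ j
  ,-injectiveʳ-fibre = ,-injectiveʳ-UIP (Decidable⇒UIP.≡-irrelevant _≟ᵛ_)

  covers-∈ : ∀ A {v} → Covers A v → ∀ w → fibre w ≡ v → A w ≡ true
  covers-∈ A covered (_ , i) refl = covered i

  admissible-shadow : ∀ {A} (adm : Admissible A) v → proj₁ v ⊑ proj₁ adm ⇔ Covers A v
  admissible-shadow (_ , shadow) v = mk⇔ (proj₂ (shadow v)) (proj₁ (shadow v))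

  shadow⇒admissible : ∀ {A} φ → (∀ v → proj₁ v ⊑ φ ⇔ Covers A v) → Admissible A
  shadow⇒admissible φ shadow = φ , λ v → Equivalence.from (shadow v) , Equivalence.to (shadow v)

  admissible-resp : ∀ {A B} → (∀ w → A w ≡ B w) → Admissible A → Admissible B
  admissible-resp A≗B (φ , shadow) = φ , λ v →
    (λ covered → proj₁ (shadow v) (λ i → trans (A≗B (v , i)) (covered i))) ,
    (λ v⊑φ i → trans (sym (A≗B (v , i))) (proj₂ (shadow v) v⊑φ i))

  module _ (σ : Ground → Ground) (σ-involutive : ∀ w → σ (σ w) ≡ w) (fibre-σ : ∀ w → fibre (σ w) ≡ fibre w) where

    covers-∘-involution : ∀ A v → Covers (A ∘ σ) v ⇔ Covers A v
    covers-∘-involution A v = mk⇔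
      (λ covered i → subst (λ w → A w ≡ true) (σ-involutive (v , i))
                           (covers-∈ (A ∘ σ) covered (σ (v , i)) (fibre-σ (v , i))))
      (λ covered i → covers-∈ A covered (σ (v , i)) (fibre-σ (v , i)))

    involution-admissible : ∀ A → Admissible A → Admissible (A ∘ σ)
    involution-admissible A A-adm = shadow⇒admissible (proj₁ A-adm) λ v →
      ⇔-trans (admissible-shadow A-adm v) (⇔-sym (covers-∘-involution A v))

  module _ (u u′ : Ground) (same-fibre : fibre u ≡ fibre u′) where
    open Transposition _≟ᴳ_

    swap-fibre : ∀ w → fibre (swap u u′ w) ≡ fibre w
    swap-fibre w with swapView u u′ w
    ... | at-ˡ refl       = trans (cong fibre (swap-ˡ w u′)) (sym same-fibre)
    ... | at-ʳ _ refl     = trans (cong fibre (swap-ʳ u w)) same-fibre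
    ... | away w≢u w≢u′   = cong fibre (swap-other u u′ w≢u w≢u′)

    swap-admissible : ∀ A → Admissible A → Admissible (A ∘ swap u u′)
    swap-admissible = involution-admissible (swap u u′) (swap-involutive u u′) swap-fibre

module BlowupProperties (N : FinRankedLattice) (f : FinRankedLattice.Vertex N → ℕ) (f-pos : ∀ v → 0 < f v) where
  open FinRankedLattice N
  open RankedLatticeProperties N
  open Blowup N f
  open BlowupBasics N f public

  basepoint : Vertex → Ground
  basepoint v = v , fromℕ< (f-pos v)

  ∅-admissible : Admissible (λ _ → false)
  ∅-admissible = 𝟎 , λ v → (λ covered → contradiction (covered (proj₂ (basepoint v))) λ ())
                         , (λ v⊑𝟎 → contradiction v⊑𝟎 (vertex⋢𝟎 (proj₂ v)))

  -- {u} covers V_x exactly when f x ≡ 1, so its face is x or 𝟎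
  singleton-admissible : ∀ u → Admissible (λ w → does (u ≟ᴳ w))
  singleton-admissible (x , i) with f x ℕ.≟ 1
  ... | yes fx≡1 = proj₁ x , λ v →
        (λ covered → ⊑-reflexive (cong (proj₁ ∘ fibre)
                       (sym (dec-true⁻¹ ((x , i) ≟ᴳ basepoint v) (covered (proj₂ (basepoint v)))))))
      , (λ v⊑x → covers-x v (Equivalence.to (vertex-⊑⇔≡ v x) v⊑x))
    where
    open IsPartialOrder isPartialOrder using () renaming (reflexive to ⊑-reflexive)
    covers-x : ∀ v → v ≡ x → Covers (λ w → does ((x , i) ≟ᴳ w)) v
    covers-x v refl j = dec-true ((x , i) ≟ᴳ (x , j)) (cong (x ,_) (Fin1-trivial fx≡1 i j))
  ... | no fx≢1 = 𝟎 , λ v → (λ covered → contradiction (f≡1 v covered) fx≢1)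
                          , (λ v⊑𝟎 → contradiction v⊑𝟎 (vertex⋢𝟎 (proj₂ v)))
    where
    f≡1 : ∀ v → Covers (λ w → does ((x , i) ≟ᴳ w)) v → f x ≡ 1
    f≡1 v covered = trans (cong (f ∘ fibre) (u≡ (proj₂ (basepoint v))))
      (≤-antisym (Fin-trivial⇒≤1 λ a b → ,-injectiveʳ-fibre (trans (sym (u≡ a)) (u≡ b))) (f-pos v))
      where
      u≡ : ∀ j → (x , i) ≡ (v , j)
      u≡ j = dec-true⁻¹ ((x , i) ≟ᴳ (v , j)) (covered j)

  isAtomicSetSystem : IsAtomicSetSystem Admissible
  isAtomicSetSystem = record
    { _≟_ = _≟ᴳ_ ; nonempty? = nonempty? ; ∅-admissible = ∅-admissible
    ; singleton-admissible = singleton-admissible ; admissible-resp = admissible-resp }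

  faceSet : Fin size → SubsetU
  faceSet φ w = does (proj₁ (fibre w) ⊑? φ)

  faceSet-admissible : ∀ φ → Admissible (faceSet φ)
  faceSet-admissible φ = shadow⇒admissible φ λ v →
    mk⇔ (λ v⊑φ _ → dec-true (proj₁ v ⊑? φ) v⊑φ)
        (λ covered → dec-true⁻¹ (proj₁ v ⊑? φ) (covered (proj₂ (basepoint v))))

module BlowupTransposition (N : FinRankedLattice) (cpm : IsCellularPseudomanifold N)
                           (f : FinRankedLattice.Vertex N → ℕ) (f-pos : ∀ v → 0 < f v) where
  open FinRankedLattice N
  open RankedLatticeProperties N
  open Blowup N f
  open BlowupProperties N f f-pos
  private
    module Tᴳ = Transposition _≟ᴳ_
    module Tᵛ = Transposition _≟ᵛ_

  module _ (u u′ : Ground) where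
    private
      x y : Vertex
      x = fibre u
      y = fibre u′

      τ : Ground → Ground
      τ = Tᴳ.swap u u′

      sw : Vertex → Vertex
      sw = Tᵛ.swap x y

    -- (V_x ∪ V_y) ∖ {u , u′}, the part of V_x ∪ V_y that τ fixes pointwise
    InC : Ground → Set
    InC w = w ≢ u × w ≢ u′ × (fibre w ≡ x ⊎ fibre w ≡ y)

    InC? : ∀ w → Dec (InC w)
    InC? w = ¬? (w ≟ᴳ u) ×-dec ¬? (w ≟ᴳ u′) ×-dec (fibre w ≟ᵛ x ⊎-dec fibre w ≟ᵛ y)

    -- probe σ φ covers exactly the v with σ v ⊑ φ (V_x, V_y through u, u′ alone), and τ turns
    -- probe id φ into probe sw φ; admissibility of the latter realises the shadow sw⁻¹(shadow φ)
    probe : (Vertex → Vertex) → Fin size → SubsetU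
    probe σ φ w = does (InC? w ⊎-dec (proj₁ (σ (fibre w)) ⊑? φ))

    outside-C : ∀ v → ∃ λ w → fibre w ≡ v × ¬ InC w
    outside-C v with v ≟ᵛ x | v ≟ᵛ y
    ... | yes refl | _        = u , refl , λ (u≢u , _) → u≢u refl
    ... | no _     | yes refl = u′ , refl , λ (_ , u′≢u′ , _) → u′≢u′ refl
    ... | no v≢x   | no v≢y   = basepoint v , refl , λ (_ , _ , v≡x∨y) → [ v≢x , v≢y ]′ v≡x∨y

    covers-probe : ∀ σ φ v → proj₁ (σ v) ⊑ φ ⇔ Covers (probe σ φ) v
    covers-probe σ φ v = case outside-C v of λ (w , fibre-w≡v , w∉C) →
      mk⇔ (λ σv⊑φ i → dec-true (InC? (v , i) ⊎-dec (proj₁ (σ v) ⊑? φ)) (inj₂ σv⊑φ))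
          (λ covered → [ ⊥-elim ∘ w∉C , subst (λ v → proj₁ (σ v) ⊑ φ) fibre-w≡v ]′
                         (dec-true⁻¹ (InC? w ⊎-dec (proj₁ (σ (fibre w)) ⊑? φ))
                                     (covers-∈ (probe σ φ) covered w fibre-w≡v)))

    τ-inside-C : ∀ {w} → InC w → τ w ≡ w
    τ-inside-C (w≢u , w≢u′ , _) = Tᴳ.swap-other u u′ w≢u w≢u′

    τ-outside-C : ∀ w → ¬ InC w → ¬ InC (τ w) × fibre (τ w) ≡ sw (fibre w)
    τ-outside-C w w∉C with Tᴳ.swapView u u′ w
    ... | Tᴳ.at-ˡ refl =
          subst (λ v → ¬ InC v) (sym (Tᴳ.swap-ˡ u u′)) (λ (_ , u′≢u′ , _) → u′≢u′ refl) ,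
          trans (cong fibre (Tᴳ.swap-ˡ u u′)) (sym (Tᵛ.swap-ˡ x y))
    ... | Tᴳ.at-ʳ _ refl =
          subst (λ v → ¬ InC v) (sym (Tᴳ.swap-ʳ u u′)) (λ (u≢u , _) → u≢u refl) ,
          trans (cong fibre (Tᴳ.swap-ʳ u u′)) (sym (Tᵛ.swap-ʳ x y))
    ... | Tᴳ.away w≢u w≢u′ =
          subst (λ v → ¬ InC v) (sym τw≡w) w∉C ,
          trans (cong fibre τw≡w) (sym (Tᵛ.swap-other x y (λ w≡x → w∉C (w≢u , w≢u′ , inj₁ w≡x))
                                                            (λ w≡y → w∉C (w≢u , w≢u′ , inj₂ w≡y))))
      where
      τw≡w : τ w ≡ w
      τw≡w = Tᴳ.swap-other u u′ w≢u w≢u′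

    membership-τ : ∀ φ w → (InC (τ w) ⊎ proj₁ (fibre (τ w)) ⊑ φ) ⇔ (InC w ⊎ proj₁ (sw (fibre w)) ⊑ φ)
    membership-τ φ w = by-cases (InC? w)
      where
      by-cases : Dec (InC w) → (InC (τ w) ⊎ proj₁ (fibre (τ w)) ⊑ φ) ⇔ (InC w ⊎ proj₁ (sw (fibre w)) ⊑ φ)
      by-cases (yes w∈C) = mk⇔ (λ _ → inj₁ w∈C) (λ _ → inj₁ (subst InC (sym (τ-inside-C w∈C)) w∈C))
      by-cases (no w∉C)  = case τ-outside-C w w∉C of λ (τw∉C , fibre-τw) →
        mk⇔ [ ⊥-elim ∘ τw∉C , inj₂ ∘ subst (λ v → proj₁ v ⊑ φ) fibre-τw ]′
            [ ⊥-elim ∘ w∉C  , inj₂ ∘ subst (λ v → proj₁ v ⊑ φ) (sym fibre-τw) ]′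

    probe-τ : ∀ φ w → probe (λ v → v) φ (τ w) ≡ probe sw φ w
    probe-τ φ w = does-⇔ (membership-τ φ w) (InC? (τ w) ⊎-dec (proj₁ (fibre (τ w)) ⊑? φ))
                                           (InC? w ⊎-dec (proj₁ (sw (fibre w)) ⊑? φ))

    transposition-admissible⇒∼ : (∀ A → Admissible A → Admissible (A ∘ τ)) →
                                 _∼_ N (proj₁ (fibre u)) (proj₁ (fibre u′))
    transposition-admissible⇒∼ τ-admissible = inj₂
      ( α , pull-isOrderIsomorphism
      , trans (pull-vertex x) (cong proj₁ (Tᵛ.swap-ˡ x y))
      , trans (pull-vertex y) (cong proj₁ (Tᵛ.swap-ʳ x y))
      , λ z z-vertex z≢x z≢y → trans (pull-vertex (z , z-vertex))
                                     (cong proj₁ (Tᵛ.swap-other x y (z≢x ∘ cong proj₁) (z≢y ∘ cong proj₁))))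
      where
      swapped-probe-admissible : ∀ φ → Admissible (probe sw φ)
      swapped-probe-admissible φ =
        admissible-resp (probe-τ φ) (τ-admissible _ (shadow⇒admissible φ (covers-probe (λ v → v) φ)))

      α : Fin size → Fin size
      α φ = proj₁ (swapped-probe-admissible φ)

      α-shadow : ∀ φ v → proj₁ v ⊑ α φ ⇔ proj₁ (sw v) ⊑ φ
      α-shadow φ v = ⇔-trans (admissible-shadow (swapped-probe-admissible φ) v) (⇔-sym (covers-probe sw φ v))

      shadowIso : ShadowIso N N
      shadowIso = record
        { π = sw ; π⁻¹ = sw ; π⁻¹∘π = Tᵛ.swap-involutive x y ; π∘π⁻¹ = Tᵛ.swap-involutive x y
        ; pull = α ; pull-shadow = α-shadow ; push = α ; push-shadow = α-shadow }

      open ShadowIsoProperties cpm cpm shadowIso using (pull-isOrderIsomorphism; pull-vertex)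

WeightedShadowIso : (N₁ : FinRankedLattice) → (FinRankedLattice.Vertex N₁ → ℕ) →
                    (N₂ : FinRankedLattice) → (FinRankedLattice.Vertex N₂ → ℕ) → Set
WeightedShadowIso N₁ f₁ N₂ f₂ = Σ (ShadowIso N₁ N₂) λ S → ∀ v → f₂ (ShadowIso.π S v) ≡ f₁ v

shadowIso⇒systemIso : ∀ {N₁ N₂ : FinRankedLattice}
                        {f₁ : FinRankedLattice.Vertex N₁ → ℕ} {f₂ : FinRankedLattice.Vertex N₂ → ℕ} →
                      WeightedShadowIso N₁ f₁ N₂ f₂ →
                      SystemIso (Blowup.Admissible N₁ f₁) (Blowup.Admissible N₂ f₂)
shadowIso⇒systemIso {N₁} {N₂} {f₁} {f₂} (S , f-compat) = record
  { to = Σ-transport π f-compat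
  ; from = Σ-transport π⁻¹ f-compat⁻¹
  ; from∘to = Σ-transport-cancel π π⁻¹ f-compat f-compat⁻¹ π⁻¹∘π
  ; to∘from = Σ-transport-cancel π⁻¹ π f-compat⁻¹ f-compat π∘π⁻¹
  ; image-admissible = image-admissible
  ; preimage-admissible = preimage-admissible
  }
  where
  open ShadowIso S
  module B₁ = BlowupBasics N₁ f₁
  module B₂ = BlowupBasics N₂ f₂

  f-compat⁻¹ : ∀ v′ → f₁ (π⁻¹ v′) ≡ f₂ v′
  f-compat⁻¹ v′ = trans (sym (f-compat (π⁻¹ v′))) (cong f₂ (π∘π⁻¹ v′))

  image-admissible : ∀ A → Blowup.Admissible N₁ f₁ A → Blowup.Admissible N₂ f₂ (A ∘ Σ-transport π⁻¹ f-compat⁻¹)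
  image-admissible A A-adm = B₂.shadow⇒admissible (push (proj₁ A-adm)) λ v′ →
    ⇔-trans (push-shadow (proj₁ A-adm) v′)
      (⇔-trans (B₁.admissible-shadow A-adm (π⁻¹ v′)) (⇔-sym (Σ-transport-covers π⁻¹ f-compat⁻¹ A v′)))

  preimage-admissible : ∀ B → Blowup.Admissible N₂ f₂ B → Blowup.Admissible N₁ f₁ (B ∘ Σ-transport π f-compat)
  preimage-admissible B B-adm = B₁.shadow⇒admissible (pull (proj₁ B-adm)) λ v →
    ⇔-trans (pull-shadow (proj₁ B-adm) v)
      (⇔-trans (B₂.admissible-shadow B-adm (π v)) (⇔-sym (Σ-transport-covers π f-compat B v)))

module SystemIsoFibres {N₁ N₂ : FinRankedLattice}
                       (cpm₂ : IsCellularPseudomanifold N₂) (prim₂ : IsPrimitive N₂)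
                       {f₁ : FinRankedLattice.Vertex N₁ → ℕ} {f₂ : FinRankedLattice.Vertex N₂ → ℕ}
                       (f₁-pos : ∀ v → 0 < f₁ v) (f₂-pos : ∀ v → 0 < f₂ v)
                       (G : SystemIso (Blowup.Admissible N₁ f₁) (Blowup.Admissible N₂ f₂)) where
  open SystemIso G
  private
    module L₁ = FinRankedLattice N₁
    module L₂ = FinRankedLattice N₂
    module B₁ = BlowupProperties N₁ f₁ f₁-pos
    module B₂ = BlowupProperties N₂ f₂ f₂-pos
    module T₁ = Transposition B₁._≟ᴳ_
    module T₂ = Transposition B₂._≟ᴳ_

  -- τ = (u u′) preserves admissibility in ⟨N₁,f₁⟩, so its conjugate (to u  to u′) does in ⟨N₂,f₂⟩
  to-respects-fibres : ∀ u u′ → B₁.fibre u ≡ B₁.fibre u′ → B₂.fibre (to u) ≡ B₂.fibre (to u′)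
  to-respects-fibres u u′ same-fibre = RankedLatticeProperties.Vertex-≡ N₂
    (prim₂ _ _ (proj₂ (B₂.fibre (to u))) (proj₂ (B₂.fibre (to u′)))
      (BlowupTransposition.transposition-admissible⇒∼ N₂ cpm₂ f₂ f₂-pos (to u) (to u′) conjugate-admissible))
    where
    conjugate-admissible : ∀ B → Blowup.Admissible N₂ f₂ B → Blowup.Admissible N₂ f₂ (B ∘ T₂.swap (to u) (to u′))
    conjugate-admissible B B-adm =
      B₂.admissible-resp (λ w → cong B (swap-conjugate B₁._≟ᴳ_ B₂._≟ᴳ_ to from from∘to to∘from u u′ w))
        (image-admissible (B ∘ to ∘ T₁.swap u u′)
          (B₁.swap-admissible u u′ same-fibre (B ∘ to) (preimage-admissible B B-adm)))

  π : L₁.Vertex → L₂.Vertex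
  π v = B₂.fibre (to (B₁.basepoint v))

  fibre-to : ∀ w → B₂.fibre (to w) ≡ π (B₁.fibre w)
  fibre-to w = to-respects-fibres w (B₁.basepoint (B₁.fibre w)) refl

  pull-admissible : ∀ ψ → Blowup.Admissible N₁ f₁ (B₂.faceSet ψ ∘ to)
  pull-admissible ψ = preimage-admissible (B₂.faceSet ψ) (B₂.faceSet-admissible ψ)

  pull : Fin L₂.size → Fin L₁.size
  pull ψ = proj₁ (pull-admissible ψ)

  pull-shadow : ∀ ψ v → proj₁ v L₁.⊑ pull ψ ⇔ proj₁ (π v) L₂.⊑ ψ
  pull-shadow ψ v = ⇔-trans (B₁.admissible-shadow (pull-admissible ψ) v) (mk⇔
    (λ covered → dec-true⁻¹ (proj₁ (π v) ⊑₂? ψ) (covered (proj₂ (B₁.basepoint v))))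
    (λ πv⊑ψ i → dec-true (proj₁ (B₂.fibre (to (v , i))) ⊑₂? ψ)
                         (subst (λ x → proj₁ x L₂.⊑ ψ) (sym (fibre-to (v , i))) πv⊑ψ)))
    where open RankedLatticeProperties N₂ using () renaming (_⊑?_ to _⊑₂?_)

  fibre-size-≤ : ∀ v v′ → π v ≡ v′ → f₁ v ≤ f₂ v′
  fibre-size-≤ v v′ πv≡v′ = injective⇒≤ {f = index} index-injective
    where
    lands : ∀ a → B₂.fibre (to (v , a)) ≡ v′
    lands a = trans (fibre-to (v , a)) πv≡v′

    index : Fin (f₁ v) → Fin (f₂ v′)
    index a = subst (Fin ∘ f₂) (lands a) (proj₂ (to (v , a)))

    index-injective : ∀ {a b} → index a ≡ index b → a ≡ b
    index-injective {a} {b} same-index = B₁.,-injectiveʳ-fibre (begin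
      (v , a)           ≡⟨ from∘to (v , a) ⟨
      from (to (v , a)) ≡⟨ cong from (subst-proj₂-injective (to (v , a)) (to (v , b))
                                                            (lands a) (lands b) same-index) ⟩
      from (to (v , b)) ≡⟨ from∘to (v , b) ⟩
      (v , b)           ∎)
      where open ≡-Reasoning

systemIso⇒shadowIso : ∀ {N₁ N₂ : FinRankedLattice}
                        {f₁ : FinRankedLattice.Vertex N₁ → ℕ} {f₂ : FinRankedLattice.Vertex N₂ → ℕ} →
                      IsCellularPseudomanifold N₁ → IsCellularPseudomanifold N₂ →
                      IsPrimitive N₁ → IsPrimitive N₂ → (∀ v → 0 < f₁ v) → (∀ v → 0 < f₂ v) →
                      SystemIso (Blowup.Admissible N₁ f₁) (Blowup.Admissible N₂ f₂) →
                      WeightedShadowIso N₁ f₁ N₂ f₂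
systemIso⇒shadowIso {N₁} {N₂} {f₁} {f₂} cpm₁ cpm₂ prim₁ prim₂ f₁-pos f₂-pos G = shadowIso , f-compat
  where
  open SystemIso G
  module Fib   = SystemIsoFibres {N₁} {N₂} cpm₂ prim₂ f₁-pos f₂-pos G
  module Fib⁻¹ = SystemIsoFibres {N₂} {N₁} cpm₁ prim₁ f₂-pos f₁-pos (SystemIso-sym G)
  module B₁ = BlowupProperties N₁ f₁ f₁-pos
  module B₂ = BlowupProperties N₂ f₂ f₂-pos

  π⁻¹∘π : ∀ v → Fib⁻¹.π (Fib.π v) ≡ v
  π⁻¹∘π v = trans (sym (Fib⁻¹.fibre-to (to (B₁.basepoint v)))) (cong B₁.fibre (from∘to (B₁.basepoint v)))

  π∘π⁻¹ : ∀ v′ → Fib.π (Fib⁻¹.π v′) ≡ v′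
  π∘π⁻¹ v′ = trans (sym (Fib.fibre-to (from (B₂.basepoint v′)))) (cong B₂.fibre (to∘from (B₂.basepoint v′)))

  shadowIso : ShadowIso N₁ N₂
  shadowIso = record
    { π = Fib.π ; π⁻¹ = Fib⁻¹.π ; π⁻¹∘π = π⁻¹∘π ; π∘π⁻¹ = π∘π⁻¹
    ; pull = Fib.pull ; pull-shadow = Fib.pull-shadow ; push = Fib⁻¹.pull ; push-shadow = Fib⁻¹.pull-shadow }

  f-compat : ∀ v → f₂ (Fib.π v) ≡ f₁ v
  f-compat v = ≤-antisym (Fib⁻¹.fibre-size-≤ (Fib.π v) v (π⁻¹∘π v)) (Fib.fibre-size-≤ v (Fib.π v) refl)

module _ {N₁ N₂ : FinRankedLattice}
         {f₁ : FinRankedLattice.Vertex N₁ → ℕ} {f₂ : FinRankedLattice.Vertex N₂ → ℕ} where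
  private
    module L₁ = FinRankedLattice N₁
    module L₂ = FinRankedLattice N₂

  shadowIso⇒compatibleIso : IsCellularPseudomanifold N₁ → IsCellularPseudomanifold N₂ →
                            WeightedShadowIso N₁ f₁ N₂ f₂ →
                            CompatibleIso N₁ f₁ N₂ f₂
  shadowIso⇒compatibleIso cpm₁ cpm₂ (S , f-compat) = pull , pull-isOrderIsomorphism , f-pull
    where
    open ShadowIso S
    open ShadowIsoProperties cpm₁ cpm₂ S using (pull-isOrderIsomorphism; pull-vertex)

    f-pull : ∀ x (p : L₂.IsVertex x) (q : L₁.IsVertex (pull x)) → f₂ (x , p) ≡ f₁ (pull x , q)
    f-pull x p q = begin
      f₂ (x , p)             ≡⟨ cong f₂ (π∘π⁻¹ (x , p)) ⟨
      f₂ (π (π⁻¹ (x , p)))   ≡⟨ f-compat (π⁻¹ (x , p)) ⟩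
      f₁ (π⁻¹ (x , p))       ≡⟨ cong f₁ (RankedLatticeProperties.Vertex-≡ N₁ (pull-vertex (x , p))) ⟨
      f₁ (pull x , q)        ∎
      where open ≡-Reasoning

  compatibleIso⇒shadowIso : CompatibleIso N₁ f₁ N₂ f₂ →
                            WeightedShadowIso N₁ f₁ N₂ f₂
  compatibleIso⇒shadowIso (φ , φ-iso , f-compat) = shadowIso , f-φ⁻¹
    where
    open OrderIsoProperties φ φ-iso using (shadowIso; φ∘φ⁻¹; φ⁻¹-vertex; φ-vertex)

    f-φ⁻¹ : ∀ v → f₂ (φ⁻¹-vertex v) ≡ f₁ v
    f-φ⁻¹ v = trans (f-compat _ _ (proj₂ (φ-vertex (φ⁻¹-vertex v))))
                    (cong f₁ (RankedLatticeProperties.Vertex-≡ N₁ (φ∘φ⁻¹ (proj₁ v))))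

lemma6p2 : (N₁ N₂ : PrimitiveCPM)
           (f₁ : PrimitiveCPM.Vertex N₁ → ℕ) (f₂ : PrimitiveCPM.Vertex N₂ → ℕ) →
           (∀ v → 0 < f₁ v) → (∀ v → 0 < f₂ v) →
           BlowupIso (PrimitiveCPM.lattice N₁) f₁ (PrimitiveCPM.lattice N₂) f₂
             ⇔ CompatibleIso (PrimitiveCPM.lattice N₁) f₁ (PrimitiveCPM.lattice N₂) f₂
lemma6p2 N₁ N₂ f₁ f₂ f₁-pos f₂-pos = mk⇔
  (shadowIso⇒compatibleIso cpm₁ cpm₂ ∘ systemIso⇒shadowIso cpm₁ cpm₂ prim₁ prim₂ f₁-pos f₂-pos
                                     ∘ orderIso⇒systemIso atomic₁ atomic₂)
  (systemIso⇒orderIso ∘ shadowIso⇒systemIso {L₁} {L₂} {f₁} {f₂} ∘ compatibleIso⇒shadowIso)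
  where
  open PrimitiveCPM N₁ using () renaming (lattice to L₁; isCPM to cpm₁; isPrimitive to prim₁)
  open PrimitiveCPM N₂ using () renaming (lattice to L₂; isCPM to cpm₂; isPrimitive to prim₂)
  atomic₁ : IsAtomicSetSystem (Blowup.Admissible L₁ f₁)
  atomic₁ = BlowupProperties.isAtomicSetSystem L₁ f₁ f₁-pos

  atomic₂ : IsAtomicSetSystem (Blowup.Admissible L₂ f₂)
  atomic₂ = BlowupProperties.isAtomicSetSystem L₂ f₂ f₂-pos
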